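{- Let $S$ be a finite set, and let $L$ be a lattice that is a meet subsemilattice of the partition lattice $\Pi_S$. If $x\in S$ and the partition $m=\{x\}\,\vert\,(S\setminus\{x\})$ belongs to $L$, then $m$ is a left-modular coatom of $L$.
   Context: $\Pi_S$ is the lattice of set partitions of $S$ ordered by refinement (finer partitions are smaller). An element $m$ of a lattice $L$ is left-modular if $(x\vee m)\wedge y=x\vee(m\wedge y)$ for all $x<y$ in $L$. A meet subsemilattice is a subset closed under the meet of $\Pi_S$. -}

module Defs where

open import Data.Nat using (ℕ)
open import Data.Fin using (Fin)
open import Data.Fin.Properties using () renaming (_≟_ to _≟ᶠ_)
open import Data.Bool using (Bool; true; false; T; _∧_)
open import Data.Bool.Properties using () renaming (_≟_ to _≟ᵇ_)
open import Data.Product using (Σ; _×_; _,_; proj₁; proj₂)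
open import Data.Sum using (_⊎_)
open import Data.Unit using (tt)
open import Relation.Nullary using (¬_)
open import Relation.Nullary.Decidable using (⌊_⌋; toWitness; fromWitness)
open import Relation.Binary.PropositionalEquality using (_≡_; refl; sym; trans)

-- Set partitions of S = Fin n, represented (as usual) by their
-- equivalence relation "i and j lie in the same block", given as a
-- decidable (Bool-valued) equivalence relation.

record Partition (n : ℕ) : Set where
  field
    rel    : Fin n → Fin n → Bool
    reflP  : ∀ i → T (rel i i)
    symP   : ∀ i j → T (rel i j) → T (rel j i)
    transP : ∀ i j k → T (rel i j) → T (rel j k) → T (rel i k)
open Partition public

module _ {n : ℕ} where

  _≤ₚ_ : Partition n → Partition n → Set
  p ≤ₚ q = ∀ i j → T (rel p i j) → T (rel q i j)

  _≈ₚ_ : Partition n → Partition n → Set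
  p ≈ₚ q = (p ≤ₚ q) × (q ≤ₚ p)

  _<ₚ_ : Partition n → Partition n → Set
  p <ₚ q = (p ≤ₚ q) × ¬ (q ≤ₚ p)

private
  T∧ : ∀ {a b} → T (a ∧ b) → T a × T b
  T∧ {true} {true} _ = tt , tt

  ∧T : ∀ {a b} → T a → T b → T (a ∧ b)
  ∧T {true} {true} _ _ = tt

_∧ₚ_ : ∀ {n} → Partition n → Partition n → Partition n
p ∧ₚ q = record
  { rel    = λ i j → rel p i j ∧ rel q i j
  ; reflP  = λ i → ∧T (reflP p i) (reflP q i)
  ; symP   = λ i j h → ∧T (symP p i j (proj₁ (T∧ h))) (symP q i j (proj₂ (T∧ h)))
  ; transP = λ i j k h₁ h₂ →
      ∧T (transP p i j k (proj₁ (T∧ h₁)) (proj₁ (T∧ h₂)))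
         (transP q i j k (proj₂ (T∧ h₁)) (proj₂ (T∧ h₂)))
  }

topₚ : ∀ {n} → Partition n
topₚ = record
  { rel = λ _ _ → true ; reflP = λ _ → tt
  ; symP = λ _ _ _ → tt ; transP = λ _ _ _ _ _ → tt }

-- the partition {x} | (S ∖ {x}) : i ~ j iff (i = x) and (j = x) have
-- the same truth value
isX : ∀ {n} → Fin n → Fin n → Bool
isX x i = ⌊ i ≟ᶠ x ⌋

split : ∀ {n} → Fin n → Partition n
split x = record
  { rel    = λ i j → ⌊ isX x i ≟ᵇ isX x j ⌋
  ; reflP  = λ i → fromWitness refl
  ; symP   = λ i j h → fromWitness (sym (toWitness h))
  ; transP = λ i j k h₁ h₂ → fromWitness (trans (toWitness h₁) (toWitness h₂))
  }

module _ {n : ℕ} (L : Partition n → Set) where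

  MeetClosed : Set
  MeetClosed = ∀ p q → L p → L q → L (p ∧ₚ q)

  Respects≈ : Set
  Respects≈ = ∀ p q → p ≈ₚ q → L p → L q

  IsJoinIn : Partition n → Partition n → Partition n → Set
  IsJoinIn p q j = L j × p ≤ₚ j × q ≤ₚ j
                 × (∀ z → L z → p ≤ₚ z → q ≤ₚ z → j ≤ₚ z)

  -- L (with the induced order) is a lattice: joins exist in L
  -- (meets exist since L is meet-closed)
  HasJoins : Set
  HasJoins = ∀ p q → L p → L q → Σ (Partition n) (IsJoinIn p q)

  IsTopOf : Partition n → Set
  IsTopOf t = L t × (∀ z → L z → z ≤ₚ t)

  IsCoatom : Partition n → Set
  IsCoatom m = L m × Σ (Partition n) λ t → IsTopOf t × m <ₚ t
             × (∀ y → L y → m ≤ₚ y → (y ≈ₚ m) ⊎ (y ≈ₚ t))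

  -- m is left-modular in L :
  -- (a ∨ m) ∧ b = a ∨ (m ∧ b) for all a < b in L, with ∨ the join of L
  -- and ∧ the meet (of Π_S, which is also the meet of L)
  IsLeftModular : Partition n → Set
  IsLeftModular m = ∀ a b → L a → L b → a <ₚ b →
                    ∀ j₁ j₂ → IsJoinIn a m j₁ → IsJoinIn a (m ∧ₚ b) j₂ →
                    (j₁ ∧ₚ b) ≈ₚ j₂

-- A partition above {x} | S∖{x} relates every two points other than x: it
-- is {x} | S∖{x} itself while x stays a singleton, and 1̂ as soon as x is
-- glued to another point. For left-modularity let m = {x} | S∖{x} and a < b
-- in L. If x is a singleton of a then a ≤ m, so a ∨ m = m and
-- (a ∨ m) ∧ b = m ∧ b ≤ a ∨ (m ∧ b). Otherwise a glues x to some j, and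
-- a ∨ (m ∧ b) contains all pairs of b avoiding x together with the link
-- x ~ j, hence contains b. The reverse inequality holds in every lattice.
module Submission where

open import Defs
open import Data.Nat using (ℕ; _≤_; s≤s; z≤n)
open import Data.Fin using (Fin; punchIn; zero)
open import Data.Fin.Properties using (any?; punchInᵢ≢i) renaming (_≟_ to _≟ᶠ_)
open import Data.Bool using (T)
open import Data.Bool.Properties using (T-∧)
open import Data.Product using (_×_; _,_; proj₁; proj₂; ∃)
open import Data.Sum using (_⊎_; inj₁; inj₂)
open import Data.Unit using (tt)
open import Data.Empty using (⊥-elim)
open import Function.Bundles using (Equivalence)
open import Relation.Nullary using (¬_; Dec; yes; no)
open import Relation.Nullary.Decidable using (T?; ¬?; _×-dec_)
open import Relation.Binary.PropositionalEquality using (refl; _≢_)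

open Equivalence

module _ {n : ℕ} where

  -- _≤ₚ_ unfolds to a function type from which its arguments cannot be
  -- inferred, so the partitions are explicit arguments throughout.

  ≤ₚ-refl : ∀ (p : Partition n) → p ≤ₚ p
  ≤ₚ-refl _ _ _ h = h

  ≤ₚ-trans : ∀ (p q r : Partition n) → p ≤ₚ q → q ≤ₚ r → p ≤ₚ r
  ≤ₚ-trans _ _ _ p≤q q≤r i k h = q≤r i k (p≤q i k h)

  ≤ₚ-topₚ : ∀ (p : Partition n) → p ≤ₚ topₚ
  ≤ₚ-topₚ _ _ _ _ = tt

  ∧ₚ-lowerˡ : ∀ (p q : Partition n) → (p ∧ₚ q) ≤ₚ p
  ∧ₚ-lowerˡ p q i k h = proj₁ (to T-∧ h)

  ∧ₚ-lowerʳ : ∀ (p q : Partition n) → (p ∧ₚ q) ≤ₚ q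
  ∧ₚ-lowerʳ p q i k h = proj₂ (to T-∧ h)

  ∧ₚ-greatest : ∀ (p q r : Partition n) → r ≤ₚ p → r ≤ₚ q → r ≤ₚ (p ∧ₚ q)
  ∧ₚ-greatest _ _ _ r≤p r≤q i k h = from T-∧ (r≤p i k h , r≤q i k h)

  ∧ₚ-monoˡ : ∀ (p p′ q : Partition n) → p ≤ₚ p′ → (p ∧ₚ q) ≤ₚ (p′ ∧ₚ q)
  ∧ₚ-monoˡ p p′ q p≤p′ =
    ∧ₚ-greatest p′ q (p ∧ₚ q) (≤ₚ-trans (p ∧ₚ q) p p′ (∧ₚ-lowerˡ p q) p≤p′) (∧ₚ-lowerʳ p q)

other-point : ∀ {n} → 2 ≤ n → (x : Fin n) → ∃ λ j → j ≢ x
other-point (s≤s (s≤s z≤n)) x = punchIn x zero , punchInᵢ≢i x zero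

module _ {n : ℕ} (x : Fin n) where

  Glued : Partition n → Set
  Glued p = ∃ λ j → j ≢ x × T (rel p x j)

  glued? : ∀ p → Dec (Glued p)
  glued? p = any? (λ j → ¬? (j ≟ᶠ x) ×-dec T? (rel p x j))

  split-related : ∀ {i k} → i ≢ x → k ≢ x → T (rel (split x) i k)
  split-related {i} {k} i≢x k≢x with i ≟ᶠ x | k ≟ᶠ x
  ... | yes i≡x | _       = ⊥-elim (i≢x i≡x)
  ... | no _    | yes k≡x = ⊥-elim (k≢x k≡x)
  ... | no _    | no _    = tt

  split-separates : ∀ {j} → j ≢ x → ¬ T (rel (split x) x j)
  split-separates {j} j≢x with x ≟ᶠ x | j ≟ᶠ x
  ... | no x≢x | _       = ⊥-elim (x≢x refl)
  ... | yes _  | yes j≡x = ⊥-elim (j≢x j≡x)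
  ... | yes _  | no _    = λ ()

  split∧-related : ∀ (b : Partition n) {i k} → i ≢ x → k ≢ x →
                   T (rel b i k) → T (rel (split x ∧ₚ b) i k)
  split∧-related b i≢x k≢x h = from T-∧ (split-related i≢x k≢x , h)

  ≤split-or-glued : ∀ p → p ≤ₚ split x ⊎ Glued p
  ≤split-or-glued p with glued? p
  ... | yes g = inj₂ g
  ... | no ¬g = inj₁ p≤split
    where
    p≤split : p ≤ₚ split x
    p≤split i k h with i ≟ᶠ x | k ≟ᶠ x
    ... | yes refl | yes refl = tt
    ... | yes refl | no k≢x   = ⊥-elim (¬g (k , k≢x , h))
    ... | no i≢x   | yes refl = ⊥-elim (¬g (i , i≢x , symP p i x h))
    ... | no _     | no _     = tt

  ≤-from-link : ∀ (b q : Partition n) →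
                (∀ i k → i ≢ x → k ≢ x → T (rel b i k) → T (rel q i k)) →
                ∀ {j} → j ≢ x → T (rel b x j) → T (rel q x j) → b ≤ₚ q
  ≤-from-link b q off j≢x bxj qxj = b≤q
    where
    linked : ∀ {k} → k ≢ x → T (rel b x k) → T (rel q x k)
    linked {k} k≢x bxk =
      transP q x _ k qxj (off _ k j≢x k≢x (transP b _ x k (symP b x _ bxj) bxk))

    b≤q : b ≤ₚ q
    b≤q i k h with i ≟ᶠ x | k ≟ᶠ x
    ... | yes refl | yes refl = reflP q x
    ... | yes refl | no k≢x   = linked k≢x h
    ... | no i≢x   | yes refl = symP q x i (linked i≢x (symP b i x h))
    ... | no i≢x   | no k≢x   = off i k i≢x k≢x h

  split<topₚ : 2 ≤ n → split x <ₚ topₚ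
  split<topₚ 2≤n with other-point 2≤n x
  ... | j , j≢x = ≤ₚ-topₚ (split x) , λ top≤split → split-separates j≢x (top≤split x j tt)

  split-covered-by-topₚ : ∀ y → split x ≤ₚ y → (y ≈ₚ split x) ⊎ (y ≈ₚ topₚ)
  split-covered-by-topₚ y split≤y with ≤split-or-glued y
  ... | inj₁ y≤split = inj₁ (y≤split , split≤y)
  ... | inj₂ (j , j≢x , yxj) =
    inj₂ (≤ₚ-topₚ y , ≤-from-link topₚ y off-x j≢x tt yxj)
    where
    off-x : ∀ i k → i ≢ x → k ≢ x → T (rel topₚ i k) → T (rel y i k)
    off-x i k i≢x k≢x _ = split≤y i k (split-related i≢x k≢x)

  split-leftModular : ∀ (L : Partition n → Set) → MeetClosed L → L (split x) →
                      IsLeftModular L (split x)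
  split-leftModular L meetClosed L-split a b _ Lb (a≤b , _) j₁ j₂
    (Lj₁ , a≤j₁ , split≤j₁ , j₁-least) (_ , a≤j₂ , split∧b≤j₂ , j₂-least) =
    j₁∧b≤j₂ , j₂≤j₁∧b
    where
    j₂≤j₁∧b : j₂ ≤ₚ (j₁ ∧ₚ b)
    j₂≤j₁∧b = j₂-least (j₁ ∧ₚ b) (meetClosed j₁ b Lj₁ Lb) (∧ₚ-greatest j₁ b a a≤j₁ a≤b)
                (∧ₚ-monoˡ (split x) j₁ b split≤j₁)

    j₁∧b≤j₂ : (j₁ ∧ₚ b) ≤ₚ j₂
    j₁∧b≤j₂ with ≤split-or-glued a
    ... | inj₁ a≤split =
      ≤ₚ-trans (j₁ ∧ₚ b) (split x ∧ₚ b) j₂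
        (∧ₚ-monoˡ j₁ (split x) b (j₁-least (split x) L-split a≤split (≤ₚ-refl (split x))))
        split∧b≤j₂
    ... | inj₂ (j , j≢x , axj) =
      ≤ₚ-trans (j₁ ∧ₚ b) b j₂ (∧ₚ-lowerʳ j₁ b)
        (≤-from-link b j₂ (λ i k i≢x k≢x h → split∧b≤j₂ i k (split∧-related b i≢x k≢x h))
                     j≢x (a≤b x j axj) (a≤j₂ x j axj))

-- Joins in L are supplied by IsLeftModular itself, and membership in L is
-- never transported along ≈ₚ.
theorem4p2 : (n : ℕ) → 2 ≤ n → (L : Partition n → Set) →
    Respects≈ L → MeetClosed L → HasJoins L → L topₚ →
    (x : Fin n) → L (split x) →
    IsCoatom L (split x) × IsLeftModular L (split x)
theorem4p2 n 2≤n L _ meetClosed _ L-top x L-split =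
  (L-split , topₚ , (L-top , λ y _ → ≤ₚ-topₚ y) , split<topₚ x 2≤n ,
    λ y _ → split-covered-by-topₚ x y)
  , split-leftModular x L meetClosed L-split
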